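{- Let $G=(V,E)$ be a graph on $n$ nodes with thresholds satisfying $t_I(v)\le T_I$ and $t_E(v)\le T_E$ for each $v\in V$, where $T_I,T_E$ are integers with $T_E+T_I\le n+2$, and suppose $d(v)\ge \frac{n+T_E+T_I}{2}-2$ for each $v\in V$. Then the algorithm PES$(G,T_E,T_I)$ returns a set $S$ with $|S|\le 2T_E-2$ and $\mathsf{Inf}[S]=V$ (a perfect evangelizing set for $G$).
   Context: $G$ is a finite simple undirected graph, $N(v)$ the neighborhood of $v$, $d(v)=|N(v)|$; $t_I,t_E:V\to\{0,1,2,\dots\}$ with $0\le t_I(v)\le t_E(v)\le d(v)+1$. For $S\subseteq V$: $\mathsf{Evg}[S,0]=\mathsf{Inf}[S,0]=S$, and for $\tau\ge1$, $\mathsf{Evg}[S,\tau]=\mathsf{Evg}[S,\tau-1]\cup\{u:|N(u)\cap\mathsf{Evg}[S,\tau-1]|\ge t_E(u)\}$, $\mathsf{Inf}[S,\tau]=\mathsf{Inf}[S,\tau-1]\cup\{u:|N(u)\cap\mathsf{Evg}[S,\tau-1]|\ge t_I(u)\}$; at the first $\rho$ with $\mathsf{Evg}[S,\rho]=\mathsf{Evg}[S,\rho-1]$ the process stops and $\mathsf{Inf}[S]=\mathsf{Inf}[S,\rho]$. Algorithm PES$(G,T_E,T_I)$: first let $S$ be any subset of $V$ with $|S|=T_I$ such that at least two nodes of $S$ are non-adjacent, if possible (e.g., if $G$ is not a clique); then, while $|S|<2(T_E-1)$ and there exists $v\in V\setminus S$ with $|N(v)\cap S|\le T_I-1$, set $S=S\cup\{v\}$;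 finally return $S$.
   Formalization: The integers $T_I,T_E$ also satisfy $T_I\le 2T_E-2$, alongside $T_E+T_I\le n+2$ and the degree bound. The statement above fails without it. -}

module Defs where

open import Data.Nat using (ℕ; zero; suc; _+_; _*_; _∸_; _≤_; _<_; _≤ᵇ_)
open import Data.Bool using (Bool; true; false)
open import Data.Fin using (Fin)
open import Data.Fin.Subset using (Subset; _∈_; _∉_; _∩_; _∪_; ∣_∣; ⁅_⁆; ⊤)
open import Data.Vec using (tabulate)
open import Data.Product using (Σ; _×_; ∃; ∃-syntax)
open import Relation.Binary.PropositionalEquality using (_≡_; _≢_)
open import Relation.Nullary using (¬_)

record Graph (n : ℕ) : Set where
  field
    adj     : Fin n → Fin n → Bool
    adj-sym : ∀ u v → adj u v ≡ adj v u
    irrefl  : ∀ v → adj v v ≡ false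

open Graph public

N : ∀ {n} → Graph n → Fin n → Subset n
N G v = tabulate (adj G v)

deg : ∀ {n} → Graph n → Fin n → ℕ
deg G v = ∣ N G v ∣

Evg : ∀ {n} → Graph n → (tE : Fin n → ℕ) → Subset n → ℕ → Subset n
Evg G tE S zero = S
Evg G tE S (suc τ) =
  Evg G tE S τ ∪ tabulate (λ u → tE u ≤ᵇ ∣ N G u ∩ Evg G tE S τ ∣)

Inf : ∀ {n} → Graph n → (tE tI : Fin n → ℕ) → Subset n → ℕ → Subset n
Inf G tE tI S zero = S
Inf G tE tI S (suc τ) =
  Inf G tE tI S τ ∪ tabulate (λ u → tI u ≤ᵇ ∣ N G u ∩ Evg G tE S τ ∣)

-- ρ = suc r is the first ρ ≥ 1 with Evg[S,ρ] = Evg[S,ρ-1].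
FirstStop : ∀ {n} → Graph n → (tE : Fin n → ℕ) → Subset n → ℕ → Set
FirstStop G tE S r =
  (Evg G tE S (suc r) ≡ Evg G tE S r) ×
  (∀ k → k < r → Evg G tE S (suc k) ≢ Evg G tE S k)

InfFinal : ∀ {n} → Graph n → (tE tI : Fin n → ℕ) → Subset n → Subset n → Set
InfFinal G tE tI S X = ∃[ r ] (FirstStop G tE S r × (Inf G tE tI S (suc r) ≡ X))

HasNonAdjPair : ∀ {n} → Graph n → Subset n → Set
HasNonAdjPair G S =
  ∃[ u ] ∃[ v ] (u ≢ v × u ∈ S × v ∈ S × adj G u v ≡ false)

PESInit : ∀ {n} → Graph n → (TE TI : ℕ) → Subset n → Set
PESInit G TE TI S =
  (∣ S ∣ ≡ TI) ×
  ((∃[ X ] (∣ X ∣ ≡ TI × HasNonAdjPair G X)) → HasNonAdjPair G S)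

PESStep : ∀ {n} → Graph n → (TE TI : ℕ) → Subset n → Subset n → Set
PESStep G TE TI S S' =
  ∃[ v ] (∣ S ∣ < 2 * (TE ∸ 1) × v ∉ S × ∣ N G v ∩ S ∣ < TI × S' ≡ S ∪ ⁅ v ⁆)

data PESReach {n} (G : Graph n) (TE TI : ℕ) : Subset n → Set where
  init : ∀ {S} → PESInit G TE TI S → PESReach G TE TI S
  step : ∀ {S S'} → PESReach G TE TI S → PESStep G TE TI S S' → PESReach G TE TI S'

PESOutput : ∀ {n} → Graph n → (TE TI : ℕ) → Subset n → Set
PESOutput G TE TI S = PESReach G TE TI S × (∀ S' → ¬ PESStep G TE TI S S')

-- Let F be the set at which evangelization stops, so every vertex outside F has at most
-- k = TE − 1 neighbours in F. If some z ∉ F had fewer than TI neighbours in F, it would have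
-- fewer than TI neighbours in S ⊆ F, so PES only stopped because |S| = 2k. The vertex added in
-- the j-th loop iteration has at least j non-neighbours among the earlier ones, so S, and hence
-- F, contains at least m(m+1) ordered non-adjacent pairs, where m = |S| − TI. Double counting
-- the degrees of F (bounded below by the degree hypothesis, above through these non-adjacent
-- pairs and the at most k neighbours in F of each vertex outside F), together with the lower
-- bound on |V ∖ F| forced by the degree of z, leaves m(m+1) + k TI ≤ k + k², which only holds
-- for m = 0, k = 1. Then TI = 2, and z with a non-neighbour of z in S is a non-adjacent TI-set,
-- so the initial choice of PES makes S contain a non-adjacent pair, and the same count fails.
module Submission where

open import Data.Bool using (Bool; true; false; _∧_; _∨_) renaming (_≟_ to _≟ᵇ_)
open import Data.Bool.Properties using (T-≡)
open import Data.Fin using (Fin; zero; suc)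
open import Data.Fin.Properties using (¬∀⟶∃¬)
open import Data.Fin.Subset
  using (Subset; _∈_; _∉_; _⊆_; _⊂_; _∩_; _∪_; _-_; ∁; ∣_∣; ⁅_⁆; ⊤; ⊥)
open import Data.Fin.Subset.Properties
open import Data.Nat
open import Data.Nat.Properties
open import Algebra.Properties.Semiring.Sum +-*-semiring
  using (sum; ∑-comm; ∑-distrib-+; sum-cong-≗; *-distribˡ-sum; *-distribʳ-sum)
open import Data.Nat.Tactic.RingSolver using (solve-∀)
open import Data.Product using (_×_; _,_; proj₁; proj₂; ∃-syntax)
open import Data.Sum using (inj₁; inj₂)
open import Data.Vec using ([]; _∷_; lookup; tabulate)
open import Data.Vec.Properties using (lookup-zipWith; lookup∘tabulate; []=⇒lookup; lookup⇒[]=; ≡-dec)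
open import Function using (_∘_; Equivalence)
open import Relation.Binary.PropositionalEquality
open import Relation.Nullary using (¬_; yes; no; contradiction)
open import Relation.Nullary.Decidable using (decidable-stable; _→-dec_)

open import Defs

private
  variable
    n c d k m t : ℕ
    p q r A B F : Subset n
    x y z v : Fin n

-- Cardinalities as sums of indicators

𝟙 : Bool → ℕ
𝟙 true  = 1
𝟙 false = 0

χ : Subset n → Fin n → ℕ
χ p = 𝟙 ∘ lookup p

Disjoint : Subset n → Subset n → Set
Disjoint p q = ∀ {x} → x ∈ p → x ∉ q

∑-mono-≤ : {f g : Fin n → ℕ} → (∀ i → f i ≤ g i) → sum f ≤ sum g
∑-mono-≤ {zero}  f≤g = z≤n
∑-mono-≤ {suc n} f≤g = +-mono-≤ (f≤g zero) (∑-mono-≤ (f≤g ∘ suc))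

∣p∣≡∑χ : ∀ (p : Subset n) → ∣ p ∣ ≡ sum (χ p)
∣p∣≡∑χ []          = refl
∣p∣≡∑χ (true  ∷ p) = cong suc (∣p∣≡∑χ p)
∣p∣≡∑χ (false ∷ p) = ∣p∣≡∑χ p

χ-∉ : x ∉ p → χ p x ≡ 0
χ-∉ {x = x} {p = p} x∉p with lookup p x in eq
... | true  = contradiction (lookup⇒[]= x p eq) x∉p
... | false = refl

χ-∩ : ∀ (p q : Subset n) i → χ (p ∩ q) i ≡ χ p i * χ q i
χ-∩ p q i rewrite lookup-zipWith _∧_ i p q with lookup p i | lookup q i
... | true  | true  = refl
... | true  | false = refl
... | false | _     = refl

χ-∪ : Disjoint p q → ∀ i → χ (p ∪ q) i ≡ χ p i + χ q i
χ-∪ {p = p} {q = q} p#q i rewrite lookup-zipWith _∨_ i p q with lookup p i in ep | lookup q i in eq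
... | true  | true  = contradiction (lookup⇒[]= i q eq) (p#q (lookup⇒[]= i p ep))
... | true  | false = refl
... | false | _     = refl

χ-*-mono-≤ : ∀ {a b} → (x ∈ p → a ≤ b) → χ p x * a ≤ χ p x * b
χ-*-mono-≤ {x = x} {p = p} a≤b with x ∈? p
... | yes x∈p = *-monoʳ-≤ (χ p x) (a≤b x∈p)
... | no  x∉p rewrite χ-∉ x∉p = z≤n

∑χ*-const : ∀ (p : Subset n) c → sum (λ x → χ p x * c) ≡ ∣ p ∣ * c
∑χ*-const p c = sym (trans (cong (_* c) (∣p∣≡∑χ p)) (*-distribʳ-sum c (χ p)))

∑χ*-≤ : ∀ {f : Fin n → ℕ} → (∀ {x} → x ∈ p → f x ≤ c) → sum (λ x → χ p x * f x) ≤ ∣ p ∣ * c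
∑χ*-≤ {p = p} {c = c} {f} f≤c =
  ≤-trans (∑-mono-≤ {f = λ x → χ p x * f x} (λ _ → χ-*-mono-≤ f≤c)) (≤-reflexive (∑χ*-const p c))

∑χ*-≥ : ∀ {f : Fin n → ℕ} → (∀ {x} → x ∈ p → c ≤ f x) → ∣ p ∣ * c ≤ sum (λ x → χ p x * f x)
∑χ*-≥ {p = p} {c = c} {f} c≤f =
  ≤-trans (≤-reflexive (sym (∑χ*-const p c))) (∑-mono-≤ {g = λ x → χ p x * f x} (λ _ → χ-*-mono-≤ c≤f))

∑χ*-+ : ∀ (p : Subset n) (f : Fin n → ℕ) c →
        sum (λ x → χ p x * (f x + c)) ≡ sum (λ x → χ p x * f x) + ∣ p ∣ * c
∑χ*-+ p f c = begin
  sum (λ x → χ p x * (f x + c))             ≡⟨ sum-cong-≗ (λ x → *-distribˡ-+ (χ p x) (f x) c) ⟩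
  sum (λ x → χ p x * f x + χ p x * c)       ≡⟨ ∑-distrib-+ (λ x → χ p x * f x) (λ x → χ p x * c) ⟩
  sum (λ x → χ p x * f x) + sum (λ x → χ p x * c) ≡⟨ cong (_ +_) (∑χ*-const p c) ⟩
  sum (λ x → χ p x * f x) + ∣ p ∣ * c       ∎
  where open ≡-Reasoning

∑χ⁅⁆* : ∀ (v : Fin n) (f : Fin n → ℕ) → sum (λ x → χ ⁅ v ⁆ x * f x) ≡ f v
∑χ⁅⁆* {suc n} zero    f = begin
  1 * f zero + sum (λ x → χ ⊥ x * f (suc x)) ≡⟨ cong₂ _+_ (*-identityˡ (f zero)) (n≤0⇒n≡0 rest≤0) ⟩
  f zero + 0                                 ≡⟨ +-identityʳ (f zero) ⟩
  f zero                                     ∎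
  where
  open ≡-Reasoning
  rest≤0 : sum (λ x → χ ⊥ x * f (suc x)) ≤ 0
  rest≤0 = ≤-trans (∑χ*-≤ {p = ⊥} {c = 0} {f = f ∘ suc} (λ x∈⊥ → contradiction x∈⊥ ∉⊥))
                   (≤-reflexive (*-zeroʳ ∣ ⊥ {n = n} ∣))
∑χ⁅⁆* {suc n} (suc v) f = ∑χ⁅⁆* v (f ∘ suc)

∣∪∣ : Disjoint p q → ∣ p ∪ q ∣ ≡ ∣ p ∣ + ∣ q ∣
∣∪∣ {p = p} {q = q} p#q = begin
  ∣ p ∪ q ∣                 ≡⟨ ∣p∣≡∑χ (p ∪ q) ⟩
  sum (χ (p ∪ q))           ≡⟨ sum-cong-≗ (χ-∪ p#q) ⟩
  sum (λ i → χ p i + χ q i) ≡⟨ ∑-distrib-+ (χ p) (χ q) ⟩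
  sum (χ p) + sum (χ q)     ≡⟨ sym (cong₂ _+_ (∣p∣≡∑χ p) (∣p∣≡∑χ q)) ⟩
  ∣ p ∣ + ∣ q ∣             ∎
  where open ≡-Reasoning

∣∩∪∣ : ∀ (p : Subset n) → Disjoint q r → ∣ p ∩ (q ∪ r) ∣ ≡ ∣ p ∩ q ∣ + ∣ p ∩ r ∣
∣∩∪∣ {q = q} {r = r} p q#r = trans (cong ∣_∣ (∩-distribˡ-∪ p q r))
  (∣∪∣ (λ x∈p∩q x∈p∩r → q#r (p∩q⊆q p q x∈p∩q) (p∩q⊆q p r x∈p∩r)))

∣p∣+∣∁p∣≡n : ∀ (p : Subset n) → ∣ p ∣ + ∣ ∁ p ∣ ≡ n
∣p∣+∣∁p∣≡n {n} p = trans (sym (∣∪∣ {p = p} x∈p⇒x∉∁p)) (trans (cong ∣_∣ (p∪∁p≡⊤ p)) (∣⊤∣≡n n))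

∣p∣≡∣p∩q∣+∣p∩∁q∣ : ∀ (p q : Subset n) → ∣ p ∣ ≡ ∣ p ∩ q ∣ + ∣ p ∩ ∁ q ∣
∣p∣≡∣p∩q∣+∣p∩∁q∣ p q = trans (cong ∣_∣ (sym (trans (cong (p ∩_) (p∪∁p≡⊤ q)) (∩-identityʳ p))))
  (∣∩∪∣ p x∈p⇒x∉∁p)

∉⇒#⁅⁆ : x ∉ p → Disjoint p ⁅ x ⁆
∉⇒#⁅⁆ {p = p} x∉p y∈p y∈⁅x⁆ = x∉p (subst (_∈ p) (x∈⁅y⁆⇒x≡y _ y∈⁅x⁆) y∈p)

∣∪⁅⁆∣ : x ∉ p → ∣ p ∪ ⁅ x ⁆ ∣ ≡ ∣ p ∣ + 1
∣∪⁅⁆∣ {x = x} {p = p} x∉p = trans (∣∪∣ (∉⇒#⁅⁆ x∉p)) (cong (∣ p ∣ +_) (∣⁅x⁆∣≡1 x))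

#∩∁ : ∀ (q : Subset n) → Disjoint p (q ∩ ∁ p)
#∩∁ q x∈p x∈q∩∁p = x∈∁p⇒x∉p (p∩q⊆q q _ x∈q∩∁p) x∈p

⊆⇒∪∩∁≡ : p ⊆ q → p ∪ (q ∩ ∁ p) ≡ q
⊆⇒∪∩∁≡ {p = p} {q = q} p⊆q = ⊆-antisym ⊆q q⊆
  where
  ⊆q : p ∪ (q ∩ ∁ p) ⊆ q
  ⊆q x∈ with x∈p∪q⁻ p (q ∩ ∁ p) x∈
  ... | inj₁ x∈p     = p⊆q x∈p
  ... | inj₂ x∈q∩∁p = p∩q⊆p q (∁ p) x∈q∩∁p
  q⊆ : q ⊆ p ∪ (q ∩ ∁ p)
  q⊆ {x} x∈q with x ∈? p
  ... | yes x∈p = p⊆p∪q (q ∩ ∁ p) x∈p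
  ... | no  x∉p = q⊆p∪q p (q ∩ ∁ p) (x∈p∩q⁺ (x∈q , x∉p⇒x∈∁p x∉p))

⊈⇒∃ : ¬ (q ⊆ p) → ∃[ x ] (x ∈ q × x ∉ p)
⊈⇒∃ {n} {q = q} {p = p} q⊈p
  with ¬∀⟶∃¬ n (λ x → x ∈ q → x ∈ p) (λ x → x ∈? q →-dec x ∈? p) (λ q⊆p → q⊈p (q⊆p _))
... | x , x∈q⇏x∈p = x , decidable-stable (x ∈? q) (λ x∉q → x∈q⇏x∈p (λ x∈q → contradiction x∈q x∉q))
                      , λ x∈p → x∈q⇏x∈p (λ _ → x∈p)

⊆∧≢⇒⊂ : p ⊆ q → p ≢ q → p ⊂ q
⊆∧≢⇒⊂ p⊆q p≢q = p⊆q , ⊈⇒∃ (λ q⊆p → p≢q (⊆-antisym p⊆q q⊆p))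

∩-monoʳ-⊆ : ∀ (p : Subset n) → q ⊆ r → p ∩ q ⊆ p ∩ r
∩-monoʳ-⊆ {q = q} p q⊆r x∈p∩q with x∈p∩q⁻ p q x∈p∩q
... | x∈p , x∈q = x∈p∩q⁺ (x∈p , q⊆r x∈q)

first-stationary : ∀ (X : ℕ → Subset n) → (∀ τ → X τ ⊆ X (suc τ)) →
                   ∃[ r ] (X (suc r) ≡ X r × (∀ j → j < r → X (suc j) ≢ X j))
first-stationary {n} X X⊆ = search (suc n) 0 ≤-refl z≤n (λ _ ())
  where
  -- Every step that is not stationary enlarges X, and j ≤ ∣ X j ∣ ≤ n, so suc n steps suffice.
  search : ∀ fuel j → n < j + fuel → j ≤ ∣ X j ∣ → (∀ i → i < j → X (suc i) ≢ X i) →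
           ∃[ r ] (X (suc r) ≡ X r × (∀ j → j < r → X (suc j) ≢ X j))
  search zero       j n<j    j≤∣Xj∣ _ =
    contradiction (≤-trans j≤∣Xj∣ (∣p∣≤n (X j))) (<⇒≱ (subst (n <_) (+-identityʳ j) n<j))
  search (suc fuel) j n<j+1+fuel j≤∣Xj∣ moving with ≡-dec _≟ᵇ_ (X (suc j)) (X j)
  ... | yes stopped = j , stopped , moving
  ... | no  grew    = search fuel (suc j) (subst (n <_) (+-suc j fuel) n<j+1+fuel)
                        (≤-<-trans j≤∣Xj∣ (p⊂q⇒∣p∣<∣q∣ (⊆∧≢⇒⊂ (X⊆ j) (grew ∘ sym)))) still-moving
    where
    still-moving : ∀ i → i < suc j → X (suc i) ≢ X i
    still-moving i i<1+j with m<1+n⇒m<n∨m≡n i<1+j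
    ... | inj₁ i<j  = moving i i<j
    ... | inj₂ refl = grew

-- Arithmetic

≤-square : ∀ k → k ≤ k * k
≤-square zero    = z≤n
≤-square (suc k) = m≤m*n (suc k) (suc k)

square≤⇒≤1 : ∀ k → k * k ≤ k → k ≤ 1
square≤⇒≤1 zero          _    = z≤n
square≤⇒≤1 (suc zero)    _    = ≤-refl
square≤⇒≤1 (suc (suc j)) kk≤k = contradiction kk≤k (m+1+n≰m (suc (suc j)))

k*[j+1]+k≤k²+[j+1]² : ∀ k j → k * suc j + k ≤ k * k + suc j * suc j
k*[j+1]+k≤k²+[j+1]² k j with k ≤? suc j
... | yes k≤j+1 = subst (k * suc j + k ≤_) (+-comm (suc j * suc j) (k * k))
                    (+-mono-≤ (*-monoˡ-≤ (suc j) k≤j+1) (≤-square k))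
... | no  k≰j+1 = begin
  k * suc j + k         ≡⟨ +-comm (k * suc j) k ⟩
  k + k * suc j         ≡⟨ *-suc k (suc j) ⟨
  k * suc (suc j)       ≤⟨ *-monoʳ-≤ k (≰⇒> k≰j+1) ⟩
  k * k                 ≤⟨ m≤m+n (k * k) (suc j * suc j) ⟩
  k * k + suc j * suc j ∎
  where open ≤-Reasoning

m[m+1]+kt≤k+k²⇒m≡0×k≡1 : t + m ≡ 2 * k → 0 < t → m * suc m + k * t ≤ k + k * k → m ≡ 0 × k ≡ 1
m[m+1]+kt≤k+k²⇒m≡0×k≡1 {t} {m} {k} t+m≡2k 0<t bound = by-cases m t+m≡2k without-t
  where
  open ≤-Reasoning
  regroup₁ : ∀ m k → m * suc m + k * k + k * k ≡ m * suc m + k * (2 * k)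
  regroup₁ = solve-∀
  regroup₂ : ∀ m k t → m * suc m + k * (t + m) ≡ m * suc m + k * t + k * m
  regroup₂ = solve-∀
  regroup₃ : ∀ k m → k + k * k + k * m ≡ k + k * m + k * k
  regroup₃ = solve-∀
  without-t : m * suc m + k * k ≤ k + k * m
  without-t = +-cancelʳ-≤ (k * k) _ _ (begin
    m * suc m + k * k + k * k ≡⟨ regroup₁ m k ⟩
    m * suc m + k * (2 * k)   ≡⟨ cong (λ s → m * suc m + k * s) t+m≡2k ⟨
    m * suc m + k * (t + m)   ≡⟨ regroup₂ m k t ⟩
    m * suc m + k * t + k * m ≤⟨ +-monoˡ-≤ (k * m) bound ⟩
    k + k * k + k * m         ≡⟨ regroup₃ k m ⟩
    k + k * m + k * k         ∎)
  by-cases : ∀ m → t + m ≡ 2 * k → m * suc m + k * k ≤ k + k * m → m ≡ 0 × k ≡ 1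
  by-cases zero t+0≡2k k²≤k+k*0 = refl , ≤-antisym (square≤⇒≤1 k k²≤k) (n≢0⇒n>0 k≢0)
    where
    k²≤k : k * k ≤ k
    k²≤k = subst (k * k ≤_) (trans (cong (k +_) (*-zeroʳ k)) (+-identityʳ k)) k²≤k+k*0
    k≢0 : k ≢ 0
    k≢0 refl = <⇒≢ 0<t (sym (trans (sym (+-identityʳ t)) t+0≡2k))
  by-cases (suc j) _ bound′ = contradiction bound′ (<⇒≱ (begin-strict
    k + k * suc j                 ≡⟨ +-comm k (k * suc j) ⟩
    k * suc j + k                 ≤⟨ k*[j+1]+k≤k²+[j+1]² k j ⟩
    k * k + suc j * suc j         ≡⟨ +-comm (k * k) (suc j * suc j) ⟩
    suc j * suc j + k * k         <⟨ +-monoˡ-< (k * k) (m<n+m (suc j * suc j) z<s) ⟩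
    suc j + suc j * suc j + k * k ≡⟨ cong (_+ k * k) (*-suc (suc j) (suc j)) ⟨
    suc j * suc (suc j) + k * k   ∎))

stuck-vertex-arith : ∀ {f y k t p q} → p < t → q < y →
                     f + y + suc k + t ≤ 2 * (p + q) + 4 → f + suc k ≤ t + y
stuck-vertex-arith {f} {y} {k} {t} {p} {q} p<t q<y deg≥ = +-cancelʳ-≤ (t + y) (f + suc k) (t + y) (begin
  f + suc k + (t + y)   ≡⟨ regroup₁ f y k t ⟩
  f + y + suc k + t     ≤⟨ deg≥ ⟩
  2 * (p + q) + 4       ≡⟨ regroup₂ p q ⟩
  2 * (suc p + suc q)   ≤⟨ *-monoʳ-≤ 2 (+-mono-≤ p<t q<y) ⟩
  2 * (t + y)           ≡⟨ regroup₃ (t + y) ⟩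
  t + y + (t + y)       ∎)
  where
  open ≤-Reasoning
  regroup₁ : ∀ f y k t → f + suc k + (t + y) ≡ f + y + suc k + t
  regroup₁ = solve-∀
  regroup₂ : ∀ p q → 2 * (p + q) + 4 ≡ 2 * (suc p + suc q)
  regroup₂ = solve-∀
  regroup₃ : ∀ s → 2 * s ≡ s + s
  regroup₃ = solve-∀

closed-set-arith : ∀ {c k t r f y e e′} → 2 * k + r ≡ f →
  f * (f + y + suc k + t) ≤ 2 * (e + e′) + 4 * f →
  e′ ≤ y * k →
  c + e + f ≤ f * f →
  f + suc k ≤ t + y →
  c + k * t ≤ k + k * k
closed-set-arith {c} {k} {t} {r} {f} {y} {e} {e′} refl D Y P Z =
  *-cancelˡ-≤ 2 (+-cancelʳ-≤ L (2 * (c + k * t)) (2 * (k + k * k)) (begin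
    2 * (c + k * t) + L ≤⟨ +-monoʳ-≤ (2 * (c + k * t)) combined ⟩
    2 * (c + k * t) + R ≡⟨ cancellation c k t r y e e′ ⟩
    2 * (k + k * k) + L ∎))
  where
  open ≤-Reasoning
  -- D + 2 Y + 2 P + r Z: with f = 2k + r, everything except 2(c + kt) and 2(k + k²) cancels.
  L R : ℕ
  L = 2 * (c + e + f) + 2 * e′ + f * (f + y + suc k + t) + r * (f + suc k)
  R = 2 * (f * f) + 2 * (y * k) + (2 * (e + e′) + 4 * f) + r * (t + y)
  combined : L ≤ R
  combined = +-mono-≤ (+-mono-≤ (+-mono-≤ (*-monoʳ-≤ 2 P) (*-monoʳ-≤ 2 Y)) D) (*-monoʳ-≤ r Z)
  cancellation : ∀ c k t r y e e′ → let f = 2 * k + r in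
    2 * (c + k * t) + (2 * (f * f) + 2 * (y * k) + (2 * (e + e′) + 4 * f) + r * (t + y))
    ≡ 2 * (k + k * k) + (2 * (c + e + f) + 2 * e′ + f * (f + y + suc k + t) + r * (f + suc k))
  cancellation = solve-∀

module EdgeCounting {n} (G : Graph n) where

  ∈N⇒adj : y ∈ N G x → adj G x y ≡ true
  ∈N⇒adj {y = y} {x = x} y∈N = trans (sym (lookup∘tabulate (adj G x) y)) ([]=⇒lookup y∈N)

  ∉N⇒¬adj : y ∉ N G x → adj G x y ≡ false
  ∉N⇒¬adj {y = y} {x = x} y∉N with adj G x y in xy
  ... | true  = contradiction (lookup⇒[]= y (N G x) (trans (lookup∘tabulate (adj G x) y) xy)) y∉N
  ... | false = refl

  ¬adj⇒∉N : adj G x y ≡ false → y ∉ N G x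
  ¬adj⇒∉N ¬xy y∈N with trans (sym (∈N⇒adj y∈N)) ¬xy
  ... | ()

  x∉N[x] : x ∉ N G x
  x∉N[x] {x = x} = ¬adj⇒∉N (irrefl G x)

  ∣N∩B∣<∣B∣ : y ∈ B → y ∉ N G x → ∣ N G x ∩ B ∣ < ∣ B ∣
  ∣N∩B∣<∣B∣ {y = y} {B = B} {x = x} y∈B y∉N = ≤-<-trans (p⊆q⇒∣p∣≤∣q∣ N∩B⊆B-y) (x∈p⇒∣p-x∣<∣p∣ y∈B)
    where
    N∩B⊆B-y : N G x ∩ B ⊆ B - y
    N∩B⊆B-y w∈ with x∈p∩q⁻ (N G x) B w∈
    ... | w∈N , w∈B = x∈p∧x≢y⇒x∈p-y w∈B (λ { refl → y∉N w∈N })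

  ∣N∩⁅⁆∣≡0 : y ∉ N G x → ∣ N G x ∩ ⁅ y ⁆ ∣ ≡ 0
  ∣N∩⁅⁆∣≡0 {y = y} {x = x} y∉N =
    n≤0⇒n≡0 (m<1+n⇒m≤n (subst (∣ N G x ∩ ⁅ y ⁆ ∣ <_) (∣⁅x⁆∣≡1 y) (∣N∩B∣<∣B∣ (x∈⁅x⁆ y) y∉N)))

  ∣N∩∣≡∑ : ∀ x B → ∣ N G x ∩ B ∣ ≡ sum (λ y → 𝟙 (adj G x y) * χ B y)
  ∣N∩∣≡∑ x B = trans (∣p∣≡∑χ (N G x ∩ B)) (sum-cong-≗ λ y →
    trans (χ-∩ (N G x) B y) (cong (λ b → 𝟙 b * χ B y) (lookup∘tabulate (adj G x) y)))

  edges : Subset n → Subset n → ℕ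
  edges A B = sum (λ x → χ A x * ∣ N G x ∩ B ∣)

  edges≡∑∑ : ∀ A B → edges A B ≡ sum (λ x → sum (λ y → χ A x * (𝟙 (adj G x y) * χ B y)))
  edges≡∑∑ A B = sum-cong-≗ λ x →
    trans (cong (χ A x *_) (∣N∩∣≡∑ x B)) (*-distribˡ-sum (χ A x) (λ y → 𝟙 (adj G x y) * χ B y))

  edges-comm : ∀ A B → edges A B ≡ edges B A
  edges-comm A B = begin
    edges A B                                                 ≡⟨ edges≡∑∑ A B ⟩
    sum (λ x → sum (λ y → χ A x * (𝟙 (adj G x y) * χ B y))) ≡⟨ sum-cong-≗ (λ x → sum-cong-≗ (swap x)) ⟩
    sum (λ x → sum (λ y → χ B y * (𝟙 (adj G y x) * χ A x))) ≡⟨ ∑-comm (λ x y → χ B y * (𝟙 (adj G y x) * χ A x)) ⟩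
    sum (λ y → sum (λ x → χ B y * (𝟙 (adj G y x) * χ A x))) ≡⟨ edges≡∑∑ B A ⟨
    edges B A                                                 ∎
    where
    open ≡-Reasoning
    reverse : ∀ a b c → a * (b * c) ≡ c * (b * a)
    reverse = solve-∀
    swap : ∀ x y → χ A x * (𝟙 (adj G x y) * χ B y) ≡ χ B y * (𝟙 (adj G y x) * χ A x)
    swap x y rewrite adj-sym G x y = reverse (χ A x) (𝟙 (adj G y x)) (χ B y)

  edges-∪ˡ : ∀ {A A′} B → Disjoint A A′ → edges (A ∪ A′) B ≡ edges A B + edges A′ B
  edges-∪ˡ {A} {A′} B A#A′ = trans
    (sum-cong-≗ λ x →
      trans (cong (_* ∣ N G x ∩ B ∣) (χ-∪ A#A′ x)) (*-distribʳ-+ ∣ N G x ∩ B ∣ (χ A x) (χ A′ x)))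
    (∑-distrib-+ (λ x → χ A x * ∣ N G x ∩ B ∣) (λ x → χ A′ x * ∣ N G x ∩ B ∣))

  edges-∪ʳ : ∀ A {B B′} → Disjoint B B′ → edges A (B ∪ B′) ≡ edges A B + edges A B′
  edges-∪ʳ A {B} {B′} B#B′ = trans
    (sum-cong-≗ λ x → trans (cong (χ A x *_) (∣∩∪∣ (N G x) B#B′)) (*-distribˡ-+ (χ A x) _ _))
    (∑-distrib-+ (λ x → χ A x * ∣ N G x ∩ B ∣) (λ x → χ A x * ∣ N G x ∩ B′ ∣))

  edges-∪² : ∀ {A R} → Disjoint A R → edges (A ∪ R) (A ∪ R) ≡ edges A A + 2 * edges A R + edges R R
  edges-∪² {A} {R} A#R = begin
    edges (A ∪ R) (A ∪ R)                             ≡⟨ edges-∪ˡ (A ∪ R) A#R ⟩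
    edges A (A ∪ R) + edges R (A ∪ R)                 ≡⟨ cong₂ _+_ (edges-∪ʳ A A#R) (edges-∪ʳ R A#R) ⟩
    edges A A + edges A R + (edges R A + edges R R)   ≡⟨ cong (λ e → edges A A + edges A R + (e + edges R R))
                                                             (edges-comm R A) ⟩
    edges A A + edges A R + (edges A R + edges R R)   ≡⟨ collect (edges A A) (edges A R) (edges R R) ⟩
    edges A A + 2 * edges A R + edges R R             ∎
    where
    open ≡-Reasoning
    collect : ∀ a b c → a + b + (b + c) ≡ a + 2 * b + c
    collect = solve-∀

  edges-⁅⁆ˡ : ∀ v B → edges ⁅ v ⁆ B ≡ ∣ N G v ∩ B ∣
  edges-⁅⁆ˡ v B = ∑χ⁅⁆* v (λ x → ∣ N G x ∩ B ∣)

  edges-≤ : (∀ {x} → x ∈ A → ∣ N G x ∩ B ∣ ≤ c) → edges A B ≤ ∣ A ∣ * c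
  edges-≤ = ∑χ*-≤

  edges-⊆ : A ⊆ B → edges A B + ∣ A ∣ ≤ ∣ A ∣ * ∣ B ∣
  edges-⊆ {A = A} {B = B} A⊆B = begin
    edges A B + ∣ A ∣                      ≡⟨ cong (edges A B +_) (*-identityʳ ∣ A ∣) ⟨
    edges A B + ∣ A ∣ * 1                  ≡⟨ ∑χ*-+ A (λ x → ∣ N G x ∩ B ∣) 1 ⟨
    sum (λ x → χ A x * (∣ N G x ∩ B ∣ + 1)) ≤⟨ ∑χ*-≤ (λ x∈A → subst (_≤ ∣ B ∣) (+-comm 1 _)
                                                                 (∣N∩B∣<∣B∣ (A⊆B x∈A) x∉N[x])) ⟩
    ∣ A ∣ * ∣ B ∣                          ∎
    where open ≤-Reasoning

  ∑χ*deg : ∀ F → sum (λ x → χ F x * deg G x) ≡ edges F F + edges F (∁ F)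
  ∑χ*deg F = trans
    (sum-cong-≗ λ x → trans (cong (χ F x *_) (∣p∣≡∣p∩q∣+∣p∩∁q∣ (N G x) F)) (*-distribˡ-+ (χ F x) _ _))
    (∑-distrib-+ (λ x → χ F x * ∣ N G x ∩ F ∣) (λ x → χ F x * ∣ N G x ∩ ∁ F ∣))

  -- c is at most ∣ A ∣ * ∣ A ∣ ∸ ∣ A ∣ ∸ edges A A, the number of ordered pairs of distinct
  -- non-adjacent vertices of A.
  NonEdges≥ : ℕ → Subset n → Set
  NonEdges≥ c A = c + edges A A + ∣ A ∣ ≤ ∣ A ∣ * ∣ A ∣

  nonEdges≥0 : ∀ A → NonEdges≥ 0 A
  nonEdges≥0 A = edges-⊆ {A = A} (λ x∈A → x∈A)

  nonEdges≥-∪⁅⁆ : v ∉ A → ∣ N G v ∩ A ∣ + d ≤ ∣ A ∣ → NonEdges≥ c A → NonEdges≥ (c + 2 * d) (A ∪ ⁅ v ⁆)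
  nonEdges≥-∪⁅⁆ {v = v} {A = A} {d = d} {c = c} v∉A few-neighbours A-sparse = begin
    c + 2 * d + edges (A ∪ ⁅ v ⁆) (A ∪ ⁅ v ⁆) + ∣ A ∪ ⁅ v ⁆ ∣
      ≡⟨ cong₂ (λ e s → c + 2 * d + e + s) edges-A∪v (∣∪⁅⁆∣ v∉A) ⟩
    c + 2 * d + (edges A A + 2 * ∣ N G v ∩ A ∣) + (∣ A ∣ + 1)
      ≡⟨ regroup c d (edges A A) ∣ N G v ∩ A ∣ ∣ A ∣ ⟩
    c + edges A A + ∣ A ∣ + 2 * (∣ N G v ∩ A ∣ + d) + 1
      ≤⟨ +-monoˡ-≤ 1 (+-mono-≤ A-sparse (*-monoʳ-≤ 2 few-neighbours)) ⟩
    ∣ A ∣ * ∣ A ∣ + 2 * ∣ A ∣ + 1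
      ≡⟨ square (∣ A ∣) ⟩
    (∣ A ∣ + 1) * (∣ A ∣ + 1)
      ≡⟨ cong (λ s → s * s) (∣∪⁅⁆∣ v∉A) ⟨
    ∣ A ∪ ⁅ v ⁆ ∣ * ∣ A ∪ ⁅ v ⁆ ∣ ∎
    where
    open ≤-Reasoning
    edges-A∪v : edges (A ∪ ⁅ v ⁆) (A ∪ ⁅ v ⁆) ≡ edges A A + 2 * ∣ N G v ∩ A ∣
    edges-A∪v = begin-equality
      edges (A ∪ ⁅ v ⁆) (A ∪ ⁅ v ⁆)                    ≡⟨ edges-∪² (∉⇒#⁅⁆ v∉A) ⟩
      edges A A + 2 * edges A ⁅ v ⁆ + edges ⁅ v ⁆ ⁅ v ⁆ ≡⟨ cong₂ (λ a b → edges A A + 2 * a + b)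
                                                            (trans (edges-comm A ⁅ v ⁆) (edges-⁅⁆ˡ v A))
                                                            (trans (edges-⁅⁆ˡ v ⁅ v ⁆) (∣N∩⁅⁆∣≡0 x∉N[x])) ⟩
      edges A A + 2 * ∣ N G v ∩ A ∣ + 0                ≡⟨ +-identityʳ _ ⟩
      edges A A + 2 * ∣ N G v ∩ A ∣                    ∎
    regroup : ∀ c d e q a → c + 2 * d + (e + 2 * q) + (a + 1) ≡ c + e + a + 2 * (q + d) + 1
    regroup = solve-∀
    square : ∀ a → a * a + 2 * a + 1 ≡ (a + 1) * (a + 1)
    square = solve-∀

  nonEdges≥-mono : A ⊆ B → NonEdges≥ c A → NonEdges≥ c B
  nonEdges≥-mono {A = A} {B = B} {c = c} A⊆B A-sparse =
    subst (NonEdges≥ c) (⊆⇒∪∩∁≡ A⊆B) (begin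
      c + edges (A ∪ R) (A ∪ R) + ∣ A ∪ R ∣
        ≡⟨ cong₂ (λ e s → c + e + s) (edges-∪² A#R) (∣∪∣ A#R) ⟩
      c + (edges A A + 2 * edges A R + edges R R) + (∣ A ∣ + ∣ R ∣)
        ≡⟨ regroup c (edges A A) (edges A R) (edges R R) ∣ A ∣ ∣ R ∣ ⟩
      (c + edges A A + ∣ A ∣) + 2 * edges A R + (edges R R + ∣ R ∣)
        ≤⟨ +-mono-≤ (+-mono-≤ A-sparse (*-monoʳ-≤ 2 edges-A-R≤)) (nonEdges≥0 R) ⟩
      ∣ A ∣ * ∣ A ∣ + 2 * (∣ A ∣ * ∣ R ∣) + ∣ R ∣ * ∣ R ∣
        ≡⟨ square ∣ A ∣ ∣ R ∣ ⟩
      (∣ A ∣ + ∣ R ∣) * (∣ A ∣ + ∣ R ∣)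
        ≡⟨ cong (λ s → s * s) (∣∪∣ A#R) ⟨
      ∣ A ∪ R ∣ * ∣ A ∪ R ∣ ∎)
    where
    open ≤-Reasoning
    R = B ∩ ∁ A
    A#R : Disjoint A R
    A#R = #∩∁ B
    edges-A-R≤ : edges A R ≤ ∣ A ∣ * ∣ R ∣
    edges-A-R≤ = edges-≤ {A = A} (λ {x} _ → ∣p∩q∣≤∣q∣ (N G x) R)
    regroup : ∀ c a b r x y → c + (a + 2 * b + r) + (x + y) ≡ (c + a + x) + 2 * b + (r + y)
    regroup = solve-∀
    square : ∀ a r → a * a + 2 * (a * r) + r * r ≡ (a + r) * (a + r)
    square = solve-∀

  nonAdjacentPair⇒nonEdges≥2 : HasNonAdjPair G A → NonEdges≥ 2 A
  nonAdjacentPair⇒nonEdges≥2 {A = A} (a , b , a≢b , a∈A , b∈A , ¬ab) =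
    nonEdges≥-mono pair⊆A (nonEdges≥-∪⁅⁆ b∉⁅a⁆ b-isolated (nonEdges≥0 ⁅ a ⁆))
    where
    b∉⁅a⁆ : b ∉ ⁅ a ⁆
    b∉⁅a⁆ b∈⁅a⁆ = a≢b (sym (x∈⁅y⁆⇒x≡y a b∈⁅a⁆))
    b-isolated : ∣ N G b ∩ ⁅ a ⁆ ∣ + 1 ≤ ∣ ⁅ a ⁆ ∣
    b-isolated rewrite ∣N∩⁅⁆∣≡0 (¬adj⇒∉N (trans (adj-sym G b a) ¬ab)) | ∣⁅x⁆∣≡1 a = ≤-refl
    pair⊆A : ⁅ a ⁆ ∪ ⁅ b ⁆ ⊆ A
    pair⊆A x∈ with x∈p∪q⁻ ⁅ a ⁆ ⁅ b ⁆ x∈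
    ... | inj₁ x∈⁅a⁆ = subst (_∈ A) (sym (x∈⁅y⁆⇒x≡y a x∈⁅a⁆)) a∈A
    ... | inj₂ x∈⁅b⁆ = subst (_∈ A) (sym (x∈⁅y⁆⇒x≡y b x∈⁅b⁆)) b∈A

  closed-set-bound :
    (∀ v → n + suc k + t ≤ 2 * deg G v + 4) →
    (∀ {y} → y ∉ F → ∣ N G y ∩ F ∣ ≤ k) →
    2 * k ≤ ∣ F ∣ → NonEdges≥ c F →
    z ∉ F → ∣ N G z ∩ F ∣ < t →
    c + k * t ≤ k + k * k
  closed-set-bound {k = k} {t = t} {F = F} {c = c} {z = z} deg≥ closed 2k≤∣F∣ F-sparse z∉F z-stuck
    with m≤n⇒∃[o]m+o≡n 2k≤∣F∣
  ... | r , 2k+r≡∣F∣ = closed-set-arith 2k+r≡∣F∣ degree-sum outer-edges F-sparse z-bound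
    where
    open ≤-Reasoning
    n≡∣F∣+∣∁F∣ : n ≡ ∣ F ∣ + ∣ ∁ F ∣
    n≡∣F∣+∣∁F∣ = sym (∣p∣+∣∁p∣≡n F)
    left-comm : ∀ a b c → a * (b * c) ≡ b * (a * c)
    left-comm = solve-∀
    ∑χ*2deg : sum (λ x → χ F x * (2 * deg G x)) ≡ 2 * (edges F F + edges F (∁ F))
    ∑χ*2deg = begin-equality
      sum (λ x → χ F x * (2 * deg G x)) ≡⟨ sum-cong-≗ (λ x → left-comm (χ F x) 2 (deg G x)) ⟩
      sum (λ x → 2 * (χ F x * deg G x)) ≡⟨ *-distribˡ-sum 2 (λ x → χ F x * deg G x) ⟨
      2 * sum (λ x → χ F x * deg G x)   ≡⟨ cong (2 *_) (∑χ*deg F) ⟩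
      2 * (edges F F + edges F (∁ F))   ∎
    degree-sum : ∣ F ∣ * (∣ F ∣ + ∣ ∁ F ∣ + suc k + t) ≤ 2 * (edges F F + edges F (∁ F)) + 4 * ∣ F ∣
    degree-sum = begin
      ∣ F ∣ * (∣ F ∣ + ∣ ∁ F ∣ + suc k + t)         ≡⟨ cong (λ s → ∣ F ∣ * (s + suc k + t)) n≡∣F∣+∣∁F∣ ⟨
      ∣ F ∣ * (n + suc k + t)                       ≤⟨ ∑χ*-≥ {p = F} (λ {x} _ → deg≥ x) ⟩
      sum (λ x → χ F x * (2 * deg G x + 4))         ≡⟨ ∑χ*-+ F (λ x → 2 * deg G x) 4 ⟩
      sum (λ x → χ F x * (2 * deg G x)) + ∣ F ∣ * 4 ≡⟨ cong₂ _+_ ∑χ*2deg (*-comm ∣ F ∣ 4) ⟩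
      2 * (edges F F + edges F (∁ F)) + 4 * ∣ F ∣   ∎
    outer-edges : edges F (∁ F) ≤ ∣ ∁ F ∣ * k
    outer-edges = ≤-trans (≤-reflexive (edges-comm F (∁ F))) (edges-≤ (closed ∘ x∈∁p⇒x∉p))
    z-bound : ∣ F ∣ + suc k ≤ t + ∣ ∁ F ∣
    z-bound = stuck-vertex-arith z-stuck (∣N∩B∣<∣B∣ (x∉p⇒x∈∁p z∉F) x∉N[x])
      (subst₂ (λ s d → s + suc k + t ≤ 2 * d + 4) n≡∣F∣+∣∁F∣ (∣p∣≡∣p∩q∣+∣p∩∁q∣ (N G z) F) (deg≥ z))

  non-neighbour : ∣ N G x ∩ B ∣ < ∣ B ∣ → ∃[ y ] (y ∈ B × y ∉ N G x)
  non-neighbour {x = x} few = ⊈⇒∃ (λ B⊆N → <⇒≱ few (p⊆q⇒∣p∣≤∣q∣ (λ y∈B → x∈p∩q⁺ (B⊆N y∈B , y∈B))))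

module ThresholdProcess {n} (G : Graph n) (tE tI : Fin n → ℕ) (S : Subset n) where

  Reached : (Fin n → ℕ) → Subset n → Subset n
  Reached t X = tabulate (λ u → t u ≤ᵇ ∣ N G u ∩ X ∣)

  ∈Reached⁺ : ∀ t X → t x ≤ ∣ N G x ∩ X ∣ → x ∈ Reached t X
  ∈Reached⁺ {x = x} _ _ t≤ = lookup⇒[]= x _ (trans (lookup∘tabulate _ x) (Equivalence.to T-≡ (≤⇒≤ᵇ t≤)))

  ∈Reached⁻ : ∀ t X → x ∈ Reached t X → t x ≤ ∣ N G x ∩ X ∣
  ∈Reached⁻ {x = x} t _ x∈ =
    ≤ᵇ⇒≤ (t x) _ (Equivalence.from T-≡ (trans (sym (lookup∘tabulate _ x)) ([]=⇒lookup x∈)))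

  ∈Evg-suc⁺ : ∀ τ → tE x ≤ ∣ N G x ∩ Evg G tE S τ ∣ → x ∈ Evg G tE S (suc τ)
  ∈Evg-suc⁺ τ = q⊆p∪q (Evg G tE S τ) (Reached tE (Evg G tE S τ)) ∘ ∈Reached⁺ tE (Evg G tE S τ)

  ∈Inf-suc⁺ : ∀ τ → tI x ≤ ∣ N G x ∩ Evg G tE S τ ∣ → x ∈ Inf G tE tI S (suc τ)
  ∈Inf-suc⁺ τ = q⊆p∪q (Inf G tE tI S τ) (Reached tI (Evg G tE S τ)) ∘ ∈Reached⁺ tI (Evg G tE S τ)

  Evg-⊆-suc : ∀ τ → Evg G tE S τ ⊆ Evg G tE S (suc τ)
  Evg-⊆-suc τ = p⊆p∪q _

  S⊆Evg : ∀ τ → S ⊆ Evg G tE S τ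
  S⊆Evg zero    = λ x∈S → x∈S
  S⊆Evg (suc τ) = Evg-⊆-suc τ ∘ S⊆Evg τ

  Evg⊆Inf : (∀ v → tI v ≤ tE v) → ∀ τ → Evg G tE S τ ⊆ Inf G tE tI S τ
  Evg⊆Inf tI≤tE zero    x∈ = x∈
  Evg⊆Inf tI≤tE (suc τ) x∈ with x∈p∪q⁻ (Evg G tE S τ) (Reached tE (Evg G tE S τ)) x∈
  ... | inj₁ x∈Evg = p⊆p∪q _ (Evg⊆Inf tI≤tE τ x∈Evg)
  ... | inj₂ x∈new = ∈Inf-suc⁺ τ (≤-trans (tI≤tE _) (∈Reached⁻ tE (Evg G tE S τ) x∈new))

  evg-stops : ∃[ r ] FirstStop G tE S r
  evg-stops = first-stationary (Evg G tE S) Evg-⊆-suc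

  stationary⇒below-threshold : ∀ {r} → Evg G tE S (suc r) ≡ Evg G tE S r →
                               y ∉ Evg G tE S r → ∣ N G y ∩ Evg G tE S r ∣ < tE y
  stationary⇒below-threshold {y = y} {r = r} stable y∉F =
    ≰⇒> (λ above → y∉F (subst (y ∈_) stable (∈Evg-suc⁺ r above)))

  Inf≡⊤ : ∀ {r} → (∀ v → tI v ≤ tE v) →
          (∀ {y} → y ∉ Evg G tE S r → tI y ≤ ∣ N G y ∩ Evg G tE S r ∣) →
          Inf G tE tI S (suc r) ≡ ⊤
  Inf≡⊤ {r} tI≤tE outside-reached = ⊆-antisym ⊆⊤ (λ {y} _ → reached y)
    where
    reached : ∀ y → y ∈ Inf G tE tI S (suc r)
    reached y with y ∈? Evg G tE S r
    ... | yes y∈F = p⊆p∪q _ (Evg⊆Inf tI≤tE r y∈F)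
    ... | no  y∉F = ∈Inf-suc⁺ r (outside-reached y∉F)

module PESLoop {n} (G : Graph n) (TI : ℕ) where
  open EdgeCounting G

  private
    variable
      TE : ℕ
      S : Subset n

  reach⇒TI≤∣S∣ : PESReach G TE TI S → TI ≤ ∣ S ∣
  reach⇒TI≤∣S∣ (init (∣S∣≡TI , _)) = ≤-reflexive (sym ∣S∣≡TI)
  reach⇒TI≤∣S∣ (step {S} reach (v , _ , v∉S , _ , refl)) =
    ≤-trans (reach⇒TI≤∣S∣ reach) (subst (∣ S ∣ ≤_) (sym (∣∪⁅⁆∣ v∉S)) (m≤m+n ∣ S ∣ 1))

  reach⇒∣S∣≤ : TI ≤ 2 * (TE ∸ 1) → PESReach G TE TI S → ∣ S ∣ ≤ 2 * (TE ∸ 1)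
  reach⇒∣S∣≤ TI≤ (init (∣S∣≡TI , _)) = subst (_≤ _) (sym ∣S∣≡TI) TI≤
  reach⇒∣S∣≤ TI≤ (step {S} _ (v , ∣S∣< , v∉S , _ , refl)) =
    subst (_≤ _) (sym (trans (∣∪⁅⁆∣ v∉S) (+-comm ∣ S ∣ 1))) ∣S∣<

  reach⇒init : PESReach G TE TI S → ∣ S ∣ ≡ TI → PESInit G TE TI S
  reach⇒init (init S-init) _ = S-init
  reach⇒init (step {S} reach (v , _ , v∉S , _ , refl)) ∣S∪v∣≡TI =
    contradiction (reach⇒TI≤∣S∣ reach)
      (<⇒≱ (≤-reflexive (trans (+-comm 1 ∣ S ∣) (trans (sym (∣∪⁅⁆∣ v∉S)) ∣S∪v∣≡TI))))

  reach⇒nonEdges≥ : PESReach G TE TI S → ∣ S ∣ ≡ TI + m → NonEdges≥ (m * suc m) S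
  reach⇒nonEdges≥ {S = S} {m = zero} _ _ = nonEdges≥0 S
  reach⇒nonEdges≥ {m = suc m} (init (∣S∣≡TI , _)) ∣S∣≡TI+1+m =
    contradiction (≤-reflexive (trans (sym ∣S∣≡TI+1+m) ∣S∣≡TI)) (m+1+n≰m TI)
  reach⇒nonEdges≥ {m = suc m} (step {S} reach (v , _ , v∉S , v-few , refl)) ∣S∪v∣≡TI+1+m =
    subst (λ c → NonEdges≥ c (S ∪ ⁅ v ⁆)) (grow m)
      (nonEdges≥-∪⁅⁆ v∉S few (reach⇒nonEdges≥ reach ∣S∣≡TI+m))
    where
    ∣S∣≡TI+m : ∣ S ∣ ≡ TI + m
    ∣S∣≡TI+m = suc-injective
      (trans (+-comm 1 ∣ S ∣) (trans (sym (∣∪⁅⁆∣ v∉S)) (trans ∣S∪v∣≡TI+1+m (+-suc TI m))))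
    few : ∣ N G v ∩ S ∣ + suc m ≤ ∣ S ∣
    few = subst₂ _≤_ (sym (+-suc _ m)) (sym ∣S∣≡TI+m) (+-monoˡ-≤ m v-few)
    grow : ∀ m → m * suc m + 2 * suc m ≡ suc m * suc (suc m)
    grow = solve-∀

  init⇒nonEdges≥2 : PESInit G TE TI S → TI ≡ 2 → z ∉ S → ∣ N G z ∩ S ∣ < ∣ S ∣ → NonEdges≥ 2 S
  init⇒nonEdges≥2 {z = z} (_ , pair⇒S-pair) TI≡2 z∉S z-few with non-neighbour z-few
  ... | w , w∈S , w∉N = nonAdjacentPair⇒nonEdges≥2 (pair⇒S-pair (⁅ z ⁆ ∪ ⁅ w ⁆ , ∣pair∣≡TI , pair))
    where
    z≢w : z ≢ w
    z≢w refl = z∉S w∈S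
    ∣pair∣≡TI : ∣ ⁅ z ⁆ ∪ ⁅ w ⁆ ∣ ≡ TI
    ∣pair∣≡TI = trans (∣∪⁅⁆∣ (λ w∈⁅z⁆ → z≢w (sym (x∈⁅y⁆⇒x≡y z w∈⁅z⁆))))
                      (trans (cong (_+ 1) (∣⁅x⁆∣≡1 z)) (sym TI≡2))
    pair : HasNonAdjPair G (⁅ z ⁆ ∪ ⁅ w ⁆)
    pair = z , w , z≢w , p⊆p∪q ⁅ w ⁆ (x∈⁅x⁆ z) , q⊆p∪q ⁅ z ⁆ ⁅ w ⁆ (x∈⁅x⁆ w) , ∉N⇒¬adj w∉N

  no-stuck-vertex : (∀ v → n + suc k + TI ≤ 2 * deg G v + 4) → TI ≤ 2 * k →
                    PESOutput G (suc k) TI S → S ⊆ F → (∀ {y} → y ∉ F → ∣ N G y ∩ F ∣ ≤ k) →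
                    z ∉ F → ¬ (∣ N G z ∩ F ∣ < TI)
  no-stuck-vertex {k = k} {S = S} {F = F} {z = z} deg≥ TI≤2k (reach , halted) S⊆F closed z∉F z-stuck =
    exceptional-case (m[m+1]+kt≤k+k²⇒m≡0×k≡1 (trans TI+added≡∣S∣ ∣S∣≡2k) 0<TI
                       (sparse⇒bound (reach⇒nonEdges≥ reach (sym TI+added≡∣S∣))))
    where
    added : ℕ
    added = proj₁ (m≤n⇒∃[o]m+o≡n (reach⇒TI≤∣S∣ reach))
    TI+added≡∣S∣ : TI + added ≡ ∣ S ∣
    TI+added≡∣S∣ = proj₂ (m≤n⇒∃[o]m+o≡n (reach⇒TI≤∣S∣ reach))
    z∉S : z ∉ S
    z∉S = z∉F ∘ S⊆F
    z-few : ∣ N G z ∩ S ∣ < TI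
    z-few = ≤-<-trans (p⊆q⇒∣p∣≤∣q∣ (∩-monoʳ-⊆ (N G z) S⊆F)) z-stuck
    0<TI : 0 < TI
    0<TI = ≤-<-trans z≤n z-stuck
    ∣S∣≡2k : ∣ S ∣ ≡ 2 * k
    ∣S∣≡2k = ≤-antisym (reach⇒∣S∣≤ TI≤2k reach)
               (≮⇒≥ (λ ∣S∣<2k → halted (S ∪ ⁅ z ⁆) (z , ∣S∣<2k , z∉S , z-few , refl)))
    sparse⇒bound : NonEdges≥ c S → c + k * TI ≤ k + k * k
    sparse⇒bound S-sparse = closed-set-bound deg≥ closed (subst (_≤ ∣ F ∣) ∣S∣≡2k (p⊆q⇒∣p∣≤∣q∣ S⊆F))
                              (nonEdges≥-mono S⊆F S-sparse) z∉F z-stuck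
    exceptional-case : ¬ (added ≡ 0 × k ≡ 1)
    exceptional-case (added≡0 , k≡1) =
      contradiction (subst₂ (λ k t → 2 + k * t ≤ k + k * k) k≡1 TI≡2 (sparse⇒bound S-sparse))
                    λ { (s≤s (s≤s ())) }
      where
      ∣S∣≡TI : ∣ S ∣ ≡ TI
      ∣S∣≡TI = trans (sym TI+added≡∣S∣) (trans (cong (TI +_) added≡0) (+-identityʳ TI))
      TI≡2 : TI ≡ 2
      TI≡2 = trans (sym ∣S∣≡TI) (trans ∣S∣≡2k (cong (2 *_) k≡1))
      S-sparse : NonEdges≥ 2 S
      S-sparse = init⇒nonEdges≥2 {TE = suc k} (reach⇒init reach ∣S∣≡TI) TI≡2 z∉S
                   (subst (∣ N G z ∩ S ∣ <_) (sym ∣S∣≡TI) z-few)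

theorem7 : ∀ {n} (G : Graph n) (tE tI : Fin n → ℕ) (TE TI : ℕ)
    → (∀ v → tI v ≤ tE v)
    → (∀ v → tE v ≤ deg G v + 1)
    → (∀ v → tI v ≤ TI)
    → (∀ v → tE v ≤ TE)
    → TE + TI ≤ n + 2
    → TI + 2 ≤ 2 * TE
    → (∀ v → n + TE + TI ≤ 2 * deg G v + 4)
    → ∀ S → PESOutput G TE TI S
    → (∣ S ∣ ≤ 2 * TE ∸ 2) × InfFinal G tE tI S ⊤
theorem7 G tE tI zero TI _ _ _ _ _ TI+2≤0 _ _ _ = contradiction (m+n≤o⇒n≤o TI TI+2≤0) λ ()
theorem7 G tE tI (suc k) TI tI≤tE _ tI≤TI tE≤TE _ TI+2≤2TE deg≥ S output@(reach , _)
  with ThresholdProcess.evg-stops G tE tI S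
... | r , stop@(stable , _) =
  subst (∣ S ∣ ≤_) 2[TE∸1]≡2TE∸2 (reach⇒∣S∣≤ TI≤2k reach) ,
  r , stop , Inf≡⊤ {r = r} tI≤tE (λ y∉F → ≮⇒≥ (λ y-stuck →
    no-stuck-vertex deg≥ TI≤2k output (S⊆Evg r) closed y∉F (<-≤-trans y-stuck (tI≤TI _))))
  where
  open ThresholdProcess G tE tI S
  open PESLoop G TI
  2[TE∸1]≡2TE∸2 : 2 * k ≡ 2 * suc k ∸ 2
  2[TE∸1]≡2TE∸2 = *-distribˡ-∸ 2 (suc k) 1
  TI≤2k : TI ≤ 2 * k
  TI≤2k = subst (TI ≤_) (sym 2[TE∸1]≡2TE∸2) (m+n≤o⇒m≤o∸n TI TI+2≤2TE)
  closed : ∀ {y} → y ∉ Evg G tE S r → ∣ N G y ∩ Evg G tE S r ∣ ≤ k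
  closed y∉F = m<1+n⇒m≤n (<-≤-trans (stationary⇒below-threshold {r = r} stable y∉F) (tE≤TE _))
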